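{- D-Frege+$\forall$red is a sound refutational proof system: if an S-form DQBF has a D-Frege+$\forall$red refutation, then it is false.
   Context: An S-form DQBF is a formula $\forall U\exists E\,\phi$ where $U$ is a finite set of universal variables, $E$ a finite set of existential variables, each $x\in E$ carries a dependency set $D_x\subseteq U$, and $\phi$ is a quantifier-free propositional formula over $U\cup E$. For a universal variable $u$ set $D_u=\{u\}$. The DQBF is true iff there are functions $f_x:\{0,1\}^{D_x}\to\{0,1\}$ ($x\in E$) such that for every assignment $\tau$ to $U$, $\tau$ extended by $x\mapsto f_x(\tau|_{D_x})$ satisfies $\phi$; otherwise it is false. D-Frege+$\forall$red: a refutation of $\forall U\exists E\,\phi$ is a sequence of propositional formulas ending in the constant $0$, each obtained by one of: (Frege) an axiom or rule of a fixed Frege system (finite, sound, implicationally complete set of schematic propositional axioms and rules) applied to earlier lines; (Axiom) a conjunct of $\phi$; (IndExt) a formula $\alpha\to(v\leftrightarrow\bigwedge_{y\in Y}y)$ or $\alpha\to(v\leftrightarrow\bigvee_{y\in Y}y)$, where $\alpha$ is a conjunction of universal literals, $Y$ a set of literals of existing variables, and $v$ a fresh variable added as existential with $D_v=(\bigcup_{y\in Y}D_{\mathrm{var}(y)})\setminus\mathrm{var}(\alpha)$; ($\forall$-red) from an earlier line $L(u)$ derive $L(0)$ or $L(1)$, where $u$ is universal and no existential variable $x$ occurring in $L$ has $u\in D_x$; (prefix weakening) the prefix may be extended by a new variable not occurring in the matrix. -}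

module Defs where

open import Data.Nat using (ℕ; _≡ᵇ_)
open import Data.Bool using (Bool; true; false; if_then_else_; not; _∧_; _∨_)
open import Data.List using (List; []; _∷_; map; foldr; concatMap; filter; head)
open import Data.Bool.ListAction using (any)
open import Data.List.Membership.Propositional using (_∈_; _∉_)
open import Data.List.Relation.Unary.All using (All)
open import Data.List.Relation.Unary.Unique.Propositional using (Unique)
open import Data.Maybe using (Maybe; just)
open import Data.Product using (Σ; _×_; _,_; proj₁; proj₂)
open import Data.Sum using (_⊎_)
open import Relation.Nullary using (¬_)
open import Relation.Binary.PropositionalEquality using (_≡_)
open import Relation.Binary.Construct.Closure.ReflexiveTransitive using (Star)

data Fm : Set where
  var  : ℕ → Fm
  ⊤f   : Fm
  ⊥f   : Fm
  ¬f   : Fm → Fm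
  _∧f_ : Fm → Fm → Fm
  _∨f_ : Fm → Fm → Fm
  _⇒f_ : Fm → Fm → Fm
  _⇔f_ : Fm → Fm → Fm

Assignment : Set
Assignment = ℕ → Bool

_⇔b_ : Bool → Bool → Bool
true  ⇔b b = b
false ⇔b b = not b

eval : Assignment → Fm → Bool
eval ρ (var x)  = ρ x
eval ρ ⊤f       = true
eval ρ ⊥f       = false
eval ρ (¬f A)   = not (eval ρ A)
eval ρ (A ∧f B) = eval ρ A ∧ eval ρ B
eval ρ (A ∨f B) = eval ρ A ∨ eval ρ B
eval ρ (A ⇒f B) = not (eval ρ A) ∨ eval ρ B
eval ρ (A ⇔f B) = eval ρ A ⇔b eval ρ B

subst : (ℕ → Fm) → Fm → Fm
subst σ (var x)  = σ x
subst σ ⊤f       = ⊤f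
subst σ ⊥f       = ⊥f
subst σ (¬f A)   = ¬f (subst σ A)
subst σ (A ∧f B) = subst σ A ∧f subst σ B
subst σ (A ∨f B) = subst σ A ∨f subst σ B
subst σ (A ⇒f B) = subst σ A ⇒f subst σ B
subst σ (A ⇔f B) = subst σ A ⇔f subst σ B

vars : Fm → List ℕ
vars (var x)  = x ∷ []
vars ⊤f       = []
vars ⊥f       = []
vars (¬f A)   = vars A
vars (A ∧f B) = vars A Data.List.++ vars B
vars (A ∨f B) = vars A Data.List.++ vars B
vars (A ⇒f B) = vars A Data.List.++ vars B
vars (A ⇔f B) = vars A Data.List.++ vars B

Holds : Assignment → Fm → Set
Holds ρ A = eval ρ A ≡ true

constFm : Bool → Fm
constFm true  = ⊤f
constFm false = ⊥f

-- literals: (polarity , variable); polarity true = positive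
Lit : Set
Lit = Bool × ℕ

litFm : Lit → Fm
litFm (true  , x) = var x
litFm (false , x) = ¬f (var x)

bigAnd : List Fm → Fm
bigAnd = foldr _∧f_ ⊤f

bigOr : List Fm → Fm
bigOr = foldr _∨f_ ⊥f

_∈ᵇ_ : ℕ → List ℕ → Bool
x ∈ᵇ xs = any (λ y → x ≡ᵇ y) xs

-- Frege systems: finite list of sound schematic rules (axioms = rules
-- without premises), implicationally complete.

record Rule : Set where
  constructor rule
  field
    premises   : List Fm
    conclusion : Fm
open Rule public

SoundRule : Rule → Set
SoundRule r = ∀ (ρ : Assignment) → All (Holds ρ) (premises r) → Holds ρ (conclusion r)

data FDerivable (Rs : List Rule) (Γ : List Fm) : Fm → Set where
  hyp  : ∀ {A} → A ∈ Γ → FDerivable Rs Γ A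
  app  : ∀ {r} → r ∈ Rs → (σ : ℕ → Fm) →
         All (FDerivable Rs Γ) (map (subst σ) (premises r)) →
         FDerivable Rs Γ (subst σ (conclusion r))

Entails : List Fm → Fm → Set
Entails Γ A = ∀ (ρ : Assignment) → All (Holds ρ) Γ → Holds ρ A

record FregeSystem : Set where
  field
    rules    : List Rule
    sound    : All SoundRule rules
    complete : ∀ (Γ : List Fm) (A : Fm) → Entails Γ A → FDerivable rules Γ A
open FregeSystem public

record Prefix : Set where
  constructor mkPrefix
  field
    univ  : List ℕ
    exist : List (ℕ × List ℕ)     -- existential variables x with D_x
open Prefix public

existVars : Prefix → List ℕ
existVars P = map proj₁ (exist P)

record DQBF : Set where
  constructor mkDQBF
  field
    prefix : Prefix
    matrix : List Fm               -- φ is the conjunction of these conjuncts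
open DQBF public

matrixVars : DQBF → List ℕ
matrixVars Q = concatMap vars (matrix Q)

InPrefix : Prefix → ℕ → Set
InPrefix P x = x ∈ univ P ⊎ x ∈ existVars P

_⊆_ : List ℕ → List ℕ → Set
xs ⊆ ys = ∀ {x} → x ∈ xs → x ∈ ys

record WellFormed (Q : DQBF) : Set where
  field
    univ-unique  : Unique (univ (prefix Q))
    exist-unique : Unique (existVars (prefix Q))
    disjoint     : ∀ {x} → x ∈ univ (prefix Q) → x ∉ existVars (prefix Q)
    deps-univ    : ∀ {x D} → (x , D) ∈ exist (prefix Q) → D ⊆ univ (prefix Q)
    matrix-vars  : ∀ {x} → x ∈ matrixVars Q → InPrefix (prefix Q) x

-- Truth: Skolem functions f_x depending only on D_x.  f_x is given as a
-- function of a full assignment which only depends on the values on D_x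
-- (i.e. a function {0,1}^{D_x} → {0,1}).
DependsOnlyOn : List ℕ → (Assignment → Bool) → Set
DependsOnlyOn D g = ∀ (τ τ' : Assignment) → (∀ {u} → u ∈ D → τ u ≡ τ' u) → g τ ≡ g τ'

extend : Prefix → (ℕ → Assignment → Bool) → Assignment → Assignment
extend P f τ w = if w ∈ᵇ existVars P then f w τ else τ w

IsTrue : DQBF → Set
IsTrue Q =
  Σ (ℕ → Assignment → Bool) λ f →
    (∀ {x D} → (x , D) ∈ exist (prefix Q) → DependsOnlyOn D (f x)) ×
    (∀ (τ : Assignment) → All (Holds (extend (prefix Q) f τ)) (matrix Q))

IsFalse : DQBF → Set
IsFalse Q = ¬ IsTrue Q

-- dependency set of a variable of the prefix (D_u = {u} for universal u)
lookupDep : List (ℕ × List ℕ) → ℕ → Maybe (List ℕ)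
lookupDep []             x = Data.Maybe.nothing
lookupDep ((y , D) ∷ ys) x = if x ≡ᵇ y then just D else lookupDep ys x

dep : Prefix → ℕ → List ℕ
dep P x = Data.Maybe.fromMaybe (x ∷ []) (lookupDep (exist P) x)

extDeps : Prefix → List Lit → List Lit → List ℕ
extDeps P α Y =
  filter (λ u → Data.Bool.T? (not (u ∈ᵇ map proj₂ α)))
         (concatMap (λ l → dep P (proj₂ l)) Y)

record Config : Set where
  constructor cfg
  field
    pfx   : Prefix
    lines : List Fm                -- derived lines, most recent first
open Config public

addExist : ℕ → List ℕ → Prefix → Prefix
addExist v D P = mkPrefix (univ P) ((v , D) ∷ exist P)

addUniv : ℕ → Prefix → Prefix
addUniv u P = mkPrefix (u ∷ univ P) (exist P)

Fresh : DQBF → Config → ℕ → Set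
Fresh Q c v = ¬ InPrefix (pfx c) v × v ∉ matrixVars Q × v ∉ concatMap vars (lines c)

redSubst : ℕ → Bool → ℕ → Fm
redSubst u b w = if w ≡ᵇ u then constFm b else var w

data Step (F : FregeSystem) (Q : DQBF) : Config → Config → Set where
  frege  : ∀ {P ls r} → r ∈ rules F → (σ : ℕ → Fm) →
           All (_∈ ls) (map (subst σ) (premises r)) →
           Step F Q (cfg P ls) (cfg P (subst σ (conclusion r) ∷ ls))
  axiom  : ∀ {P ls A} → A ∈ matrix Q →
           Step F Q (cfg P ls) (cfg P (A ∷ ls))
  indExtAnd : ∀ {P ls} (α Y : List Lit) (v : ℕ) →
           All (λ l → proj₂ l ∈ univ P) α →
           All (λ l → InPrefix P (proj₂ l)) Y →
           Fresh Q (cfg P ls) v →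
           Step F Q (cfg P ls)
             (cfg (addExist v (extDeps P α Y) P)
                  ((bigAnd (map litFm α) ⇒f (var v ⇔f bigAnd (map litFm Y))) ∷ ls))
  indExtOr : ∀ {P ls} (α Y : List Lit) (v : ℕ) →
           All (λ l → proj₂ l ∈ univ P) α →
           All (λ l → InPrefix P (proj₂ l)) Y →
           Fresh Q (cfg P ls) v →
           Step F Q (cfg P ls)
             (cfg (addExist v (extDeps P α Y) P)
                  ((bigAnd (map litFm α) ⇒f (var v ⇔f bigOr (map litFm Y))) ∷ ls))
  ∀red   : ∀ {P ls L} (u : ℕ) (b : Bool) → L ∈ ls → u ∈ univ P →
           (∀ {x D} → (x , D) ∈ exist P → x ∈ vars L → u ∉ D) →
           Step F Q (cfg P ls) (cfg P (subst (redSubst u b) L ∷ ls))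
  weakenU : ∀ {P ls} (w : ℕ) → ¬ InPrefix P w → w ∉ matrixVars Q →
           Step F Q (cfg P ls) (cfg (addUniv w P) ls)
  weakenE : ∀ {P ls} (w : ℕ) (D : List ℕ) → ¬ InPrefix P w → w ∉ matrixVars Q →
           D ⊆ univ P →
           Step F Q (cfg P ls) (cfg (addExist w D P) ls)

Refutation : FregeSystem → DQBF → Set
Refutation F Q =
  Σ Config λ c → Star (Step F Q) (cfg (prefix Q) []) c × head (lines c) ≡ just ⊥f

-- Soundness by an invariant on configurations: the prefix stays well formed and the
-- DQBF whose matrix is extended by all lines derived so far stays true.  Frege steps
-- and axioms are sound pointwise.  A ∀-reduct L[u:=b] holds at τ because L holds at
-- τ[u ↦ b] and no existential variable of L reads u.  A fresh existential v is given a
-- Skolem function h; since no old Skolem function reads v, setting v to h τ does not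
-- disturb the old lines.  For the extension line α → (v ↔ B) take h τ = B evaluated
-- after forcing α to be true: this agrees with B whenever α holds, and it reads only
-- the universal variables of D_v = ⋃ D_y \ var(α).

module Submission where

open import Defs
open import Data.Nat using (ℕ; _≡ᵇ_; _≟_)
open import Data.Bool using (Bool; true; false; if_then_else_; not; _∧_; _∨_; T; T?)
open import Data.Bool.Properties using (if-float; not-injective)
open import Data.List using (List; []; _∷_; map; head; _++_)
open import Data.List.Membership.Propositional using (_∈_; _∉_; find; lose)
open import Data.List.Membership.Propositional.Properties
  using (∈-++⁺ˡ; ∈-++⁺ʳ; ∈-++⁻; ∈-map⁺; ∈-map⁻; ∈-filter⁺; ∈-filter⁻; ∈-concatMap⁺; ∈-concatMap⁻)
open import Data.List.Membership.DecPropositional _≟_ using (_∈?_)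
open import Data.List.Relation.Unary.All as All using (All; []; _∷_)
open import Data.List.Relation.Unary.All.Properties using (map⁺; map⁻)
open import Data.List.Relation.Unary.Any using (here; there)
open import Data.Maybe using (just; fromMaybe)
open import Data.Product using (_×_; _,_; proj₁; proj₂)
open import Data.Sum using (inj₁; inj₂)
open import Data.Empty using (⊥-elim)
open import Data.Unit using (tt)
open import Relation.Nullary using (¬_; does; yes; no)
open import Relation.Nullary.Decidable using (dec-true; dec-false)
open import Relation.Binary.PropositionalEquality
  using (_≡_; _≢_; _≗_; refl; sym; trans; cong; cong₂; cong-app; module ≡-Reasoning)
  renaming (subst to substᵖ)
open import Relation.Binary.Construct.Closure.ReflexiveTransitive using (Star; ε; _◅_)

≡ᵇ-≡ : ∀ {m n} → m ≡ n → (m ≡ᵇ n) ≡ true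
≡ᵇ-≡ {m} {n} = dec-true (m ≟ n)

≡ᵇ-≢ : ∀ {m n} → m ≢ n → (m ≡ᵇ n) ≡ false
≡ᵇ-≢ {m} {n} = dec-false (m ≟ n)

∈ᵇ-does : ∀ x xs → (x ∈ᵇ xs) ≡ does (x ∈? xs)
∈ᵇ-does x []       = refl
∈ᵇ-does x (y ∷ ys) = cong ((x ≡ᵇ y) ∨_) (∈ᵇ-does x ys)

∈ᵇ-∈ : ∀ {x xs} → x ∈ xs → (x ∈ᵇ xs) ≡ true
∈ᵇ-∈ {x} {xs} x∈xs = trans (∈ᵇ-does x xs) (dec-true (x ∈? xs) x∈xs)

∈ᵇ-∉ : ∀ {x xs} → x ∉ xs → (x ∈ᵇ xs) ≡ false
∈ᵇ-∉ {x} {xs} x∉xs = trans (∈ᵇ-does x xs) (dec-false (x ∈? xs) x∉xs)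

infixl 9 _[_↦_]

_[_↦_] : {A : Set} → (ℕ → A) → ℕ → A → ℕ → A
(f [ v ↦ a ]) w = if w ≡ᵇ v then a else f w

update-≡ : ∀ {A : Set} (f : ℕ → A) v a → (f [ v ↦ a ]) v ≡ a
update-≡ f v a rewrite ≡ᵇ-≡ {v} refl = refl

update-≢ : ∀ {A : Set} (f : ℕ → A) {v w} a → w ≢ v → (f [ v ↦ a ]) w ≡ f w
update-≢ f a w≢v rewrite ≡ᵇ-≢ w≢v = refl

eval-subst : ∀ ρ σ A → eval ρ (subst σ A) ≡ eval (λ w → eval ρ (σ w)) A
eval-subst ρ σ (var x)  = refl
eval-subst ρ σ ⊤f       = refl
eval-subst ρ σ ⊥f       = refl
eval-subst ρ σ (¬f A)   = cong not (eval-subst ρ σ A)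
eval-subst ρ σ (A ∧f B) = cong₂ _∧_ (eval-subst ρ σ A) (eval-subst ρ σ B)
eval-subst ρ σ (A ∨f B) = cong₂ _∨_ (eval-subst ρ σ A) (eval-subst ρ σ B)
eval-subst ρ σ (A ⇒f B) = cong₂ (λ a b → not a ∨ b) (eval-subst ρ σ A) (eval-subst ρ σ B)
eval-subst ρ σ (A ⇔f B) = cong₂ _⇔b_ (eval-subst ρ σ A) (eval-subst ρ σ B)

eval-cong : ∀ {ρ ρ'} A → (∀ {w} → w ∈ vars A → ρ w ≡ ρ' w) → eval ρ A ≡ eval ρ' A
eval-cong (var x)  ag = ag (here refl)
eval-cong ⊤f       ag = refl
eval-cong ⊥f       ag = refl
eval-cong (¬f A)   ag = cong not (eval-cong A ag)
eval-cong (A ∧f B) ag =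
  cong₂ _∧_ (eval-cong A (λ p → ag (∈-++⁺ˡ p))) (eval-cong B (λ p → ag (∈-++⁺ʳ (vars A) p)))
eval-cong (A ∨f B) ag =
  cong₂ _∨_ (eval-cong A (λ p → ag (∈-++⁺ˡ p))) (eval-cong B (λ p → ag (∈-++⁺ʳ (vars A) p)))
eval-cong (A ⇒f B) ag =
  cong₂ (λ a b → not a ∨ b) (eval-cong A (λ p → ag (∈-++⁺ˡ p))) (eval-cong B (λ p → ag (∈-++⁺ʳ (vars A) p)))
eval-cong (A ⇔f B) ag =
  cong₂ _⇔b_ (eval-cong A (λ p → ag (∈-++⁺ˡ p))) (eval-cong B (λ p → ag (∈-++⁺ʳ (vars A) p)))

holds-cong : ∀ {ρ ρ'} → ρ ≗ ρ' → ∀ {A} → Holds ρ A → Holds ρ' A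
holds-cong ρ≗ρ' {A} = trans (sym (eval-cong A (λ {w} _ → ρ≗ρ' w)))

eval-constFm : ∀ ρ b → eval ρ (constFm b) ≡ b
eval-constFm ρ true  = refl
eval-constFm ρ false = refl

eval-reduct : ∀ ρ u b L → eval ρ (subst (redSubst u b) L) ≡ eval (ρ [ u ↦ b ]) L
eval-reduct ρ u b L = trans (eval-subst ρ (redSubst u b) L) (eval-cong L (λ {w} _ → reduct-var w))
  where
  reduct-var : ∀ w → eval ρ (redSubst u b w) ≡ (ρ [ u ↦ b ]) w
  reduct-var w = trans (if-float (eval ρ) (w ≡ᵇ u)) (cong (λ c → (ρ [ u ↦ c ]) w) (eval-constFm ρ b))

sound-instance : ∀ {r} → SoundRule r → ∀ ρ σ →
                 All (Holds ρ) (map (subst σ) (premises r)) → Holds ρ (subst σ (conclusion r))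
sound-instance {r} sr ρ σ hs =
  trans (eval-subst ρ σ (conclusion r))
        (sr (λ w → eval ρ (σ w)) (All.map (λ {A} → trans (sym (eval-subst ρ σ A))) (map⁻ hs)))

⇒b-intro : ∀ {a b} → (a ≡ true → b ≡ true) → (not a ∨ b) ≡ true
⇒b-intro {false} _ = refl
⇒b-intro {true}  h = h refl

⇔b-≡ : ∀ {a b} → a ≡ b → (a ⇔b b) ≡ true
⇔b-≡ {true}  refl = refl
⇔b-≡ {false} refl = refl

vars-litFm : ∀ l {w} → w ∈ vars (litFm l) → w ≡ proj₂ l
vars-litFm (true  , x) (here w≡x) = w≡x
vars-litFm (false , x) (here w≡x) = w≡x

vars-bigAnd-lits : ∀ L {w} → w ∈ vars (bigAnd (map litFm L)) → w ∈ map proj₂ L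
vars-bigAnd-lits (l ∷ L) w∈ with ∈-++⁻ (vars (litFm l)) w∈
... | inj₁ p = here (vars-litFm l p)
... | inj₂ p = there (vars-bigAnd-lits L p)

vars-bigOr-lits : ∀ L {w} → w ∈ vars (bigOr (map litFm L)) → w ∈ map proj₂ L
vars-bigOr-lits (l ∷ L) w∈ with ∈-++⁻ (vars (litFm l)) w∈
... | inj₁ p = here (vars-litFm l p)
... | inj₂ p = there (vars-bigOr-lits L p)

litFm-holds : ∀ τ b x → Holds τ (litFm (b , x)) → τ x ≡ b
litFm-holds τ true  x h = h
litFm-holds τ false x h = not-injective h

∧-holds⁻ : ∀ {a b} → (a ∧ b) ≡ true → a ≡ true × b ≡ true
∧-holds⁻ {true} {true} refl = refl , refl

-- If α is contradictory, its first literal on each variable wins.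
makeTrue : List Lit → Assignment → Assignment
makeTrue []            τ = τ
makeTrue ((b , x) ∷ α) τ = makeTrue α τ [ x ↦ b ]

makeTrue-id : ∀ α τ → Holds τ (bigAnd (map litFm α)) → makeTrue α τ ≗ τ
makeTrue-id []            τ _ w = refl
makeTrue-id ((b , x) ∷ α) τ h w with ∧-holds⁻ h | w ≟ x
... | hx , _ | yes refl = trans (update-≡ (makeTrue α τ) w b) (sym (litFm-holds τ b w hx))
... | _ , hα | no w≢x  = trans (update-≢ (makeTrue α τ) b w≢x) (makeTrue-id α τ hα w)

makeTrue-cong : ∀ α {τ τ'} w → (w ∉ map proj₂ α → τ w ≡ τ' w) → makeTrue α τ w ≡ makeTrue α τ' w
makeTrue-cong []            w ag = ag (λ ())
makeTrue-cong ((b , x) ∷ α) {τ} {τ'} w ag with w ≟ x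
... | yes refl = trans (update-≡ (makeTrue α τ) w b) (sym (update-≡ (makeTrue α τ') w b))
... | no w≢x   = begin
  (makeTrue α τ [ x ↦ b ]) w   ≡⟨ update-≢ (makeTrue α τ) b w≢x ⟩
  makeTrue α τ w               ≡⟨ makeTrue-cong α w (λ w∉α → ag λ { (here w≡x) → w≢x w≡x
                                                                   ; (there p) → w∉α p }) ⟩
  makeTrue α τ' w              ≡⟨ sym (update-≢ (makeTrue α τ') b w≢x) ⟩
  (makeTrue α τ' [ x ↦ b ]) w  ∎
  where open ≡-Reasoning

record WellFormedPrefix (P : Prefix) : Set where
  field
    disjoint  : ∀ {x} → x ∈ univ P → x ∉ existVars P
    deps-univ : ∀ {x D} → (x , D) ∈ exist P → D ⊆ univ P
open WellFormedPrefix

wf-addExist : ∀ {P v D} → WellFormedPrefix P → ¬ InPrefix P v → D ⊆ univ P →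
              WellFormedPrefix (addExist v D P)
wf-addExist wf v∉P D⊆U = record
  { disjoint  = λ { v∈U (here refl) → v∉P (inj₁ v∈U) ; x∈U (there x∈E) → disjoint wf x∈U x∈E }
  ; deps-univ = λ { (here refl) → D⊆U ; (there x∈E) → deps-univ wf x∈E } }

wf-addUniv : ∀ {P u} → WellFormedPrefix P → ¬ InPrefix P u → WellFormedPrefix (addUniv u P)
wf-addUniv wf u∉P = record
  { disjoint  = λ { (here refl) u∈E → u∉P (inj₂ u∈E) ; (there x∈U) → disjoint wf x∈U }
  ; deps-univ = λ x∈E y∈D → there (deps-univ wf x∈E y∈D) }

wellFormedPrefix : ∀ {Q} → WellFormed Q → WellFormedPrefix (prefix Q)
wellFormedPrefix wf = record { disjoint = WellFormed.disjoint wf ; deps-univ = WellFormed.deps-univ wf }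

SkolemFor : Prefix → (ℕ → Assignment → Bool) → Set
SkolemFor P f = ∀ {x D} → (x , D) ∈ exist P → DependsOnlyOn D (f x)

data DepView (E : List (ℕ × List ℕ)) (x : ℕ) : List ℕ → Set where
  existential     : ∀ {D} → (x , D) ∈ E → DepView E x D
  non-existential : x ∉ map proj₁ E → DepView E x (x ∷ [])

depView : ∀ P x → DepView (exist P) x (dep P x)
depView P x = go (exist P)
  where
  skip : ∀ {E y D′ D} → x ≢ y → DepView E x D → DepView ((y , D′) ∷ E) x D
  skip x≢y (existential x∈E)     = existential (there x∈E)
  skip x≢y (non-existential x∉E) = non-existential λ { (here x≡y) → x≢y x≡y ; (there p) → x∉E p }

  go : ∀ E → DepView E x (fromMaybe (x ∷ []) (lookupDep E x))
  go []            = non-existential λ ()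
  go ((y , D) ∷ E) with x ≟ y
  ... | yes refl rewrite ≡ᵇ-≡ {x} refl = existential (here refl)
  ... | no x≢y   rewrite ≡ᵇ-≢ x≢y      = skip x≢y (go E)

∉-dep : ∀ {P u w} → w ≢ u → (∀ {D} → (w , D) ∈ exist P → u ∉ D) → u ∉ dep P w
∉-dep {P} {u} {w} w≢u u∉D with dep P w | depView P w
... | _ | existential w∈E   = u∉D w∈E
... | _ | non-existential _ = λ { (here u≡w) → w≢u (sym u≡w) }

dep-⊆-univ : ∀ {P x} → WellFormedPrefix P → InPrefix P x → dep P x ⊆ univ P
dep-⊆-univ {P} {x} wf x∈P with dep P x | depView P x | x∈P
... | _ | existential x∈E     | _        = deps-univ wf x∈E
... | _ | non-existential x∉E | inj₁ x∈U = λ { (here refl) → x∈U }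
... | _ | non-existential x∉E | inj₂ x∈E = ⊥-elim (x∉E x∈E)

extend-∈ : ∀ P f τ {x} → x ∈ existVars P → extend P f τ x ≡ f x τ
extend-∈ P f τ x∈E rewrite ∈ᵇ-∈ x∈E = refl

extend-∉ : ∀ P f τ {x} → x ∉ existVars P → extend P f τ x ≡ τ x
extend-∉ P f τ x∉E rewrite ∈ᵇ-∉ x∉E = refl

extend-cong : ∀ {P f τ τ'} → SkolemFor P f → ∀ w →
              (∀ {u} → u ∈ dep P w → τ u ≡ τ' u) → extend P f τ w ≡ extend P f τ' w
extend-cong {P} {f} {τ} {τ'} sk w ag with dep P w | depView P w
... | _ | existential w∈D =
  trans (extend-∈ P f τ w∈E) (trans (sk w∈D τ τ' ag) (sym (extend-∈ P f τ' w∈E)))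
  where w∈E = ∈-map⁺ proj₁ w∈D
... | _ | non-existential w∉E =
  trans (extend-∉ P f τ w∉E) (trans (ag (here refl)) (sym (extend-∉ P f τ' w∉E)))

extend-update : ∀ {P f τ u b w} → SkolemFor P f → u ∉ existVars P →
                (∀ {D} → (w , D) ∈ exist P → u ∉ D) →
                extend P f (τ [ u ↦ b ]) w ≡ (extend P f τ [ u ↦ b ]) w
extend-update {P} {f} {τ} {u} {b} {w} sk u∉E u∉D with w ≟ u
... | yes refl =
  trans (extend-∉ P f (τ [ u ↦ b ]) u∉E) (trans (update-≡ τ w b) (sym (update-≡ (extend P f τ) w b)))
... | no w≢u   = trans (extend-cong {P} sk w τ[u↦b]≈τ) (sym (update-≢ (extend P f τ) b w≢u))
  where
  τ[u↦b]≈τ : ∀ {z} → z ∈ dep P w → (τ [ u ↦ b ]) z ≡ τ z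
  τ[u↦b]≈τ {z} z∈ = update-≢ τ b (λ z≡u → ∉-dep {P} w≢u u∉D (substᵖ (_∈ dep P w) z≡u z∈))

extend-addExist : ∀ {P f} v D h τ →
                  extend (addExist v D P) (f [ v ↦ h ]) τ ≗ (extend P f τ [ v ↦ h τ ])
extend-addExist {P} {f} v D h τ w with w ≟ v
... | yes refl = begin
  extend (addExist v D P) (f [ v ↦ h ]) τ w  ≡⟨ extend-∈ (addExist v D P) (f [ v ↦ h ]) τ (here refl) ⟩
  (f [ v ↦ h ]) w τ                          ≡⟨ cong-app (update-≡ f w h) τ ⟩
  h τ                                        ≡⟨ sym (update-≡ (extend P f τ) w (h τ)) ⟩
  (extend P f τ [ v ↦ h τ ]) w               ∎
  where open ≡-Reasoning
... | no w≢v with w ∈? existVars P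
...   | yes w∈E = begin
  extend (addExist v D P) (f [ v ↦ h ]) τ w  ≡⟨ extend-∈ (addExist v D P) (f [ v ↦ h ]) τ (there w∈E) ⟩
  (f [ v ↦ h ]) w τ                          ≡⟨ cong-app (update-≢ f h w≢v) τ ⟩
  f w τ                                      ≡⟨ sym (extend-∈ P f τ w∈E) ⟩
  extend P f τ w                             ≡⟨ sym (update-≢ (extend P f τ) (h τ) w≢v) ⟩
  (extend P f τ [ v ↦ h τ ]) w               ∎
  where open ≡-Reasoning
...   | no w∉E = begin
  extend (addExist v D P) (f [ v ↦ h ]) τ w  ≡⟨ extend-∉ (addExist v D P) (f [ v ↦ h ]) τ
                                                   (λ { (here w≡v) → w≢v w≡v ; (there p) → w∉E p }) ⟩
  τ w                                        ≡⟨ sym (extend-∉ P f τ w∉E) ⟩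
  extend P f τ w                             ≡⟨ sym (update-≢ (extend P f τ) (h τ) w≢v) ⟩
  (extend P f τ [ v ↦ h τ ]) w               ∎
  where open ≡-Reasoning

∈-extDeps⁺ : ∀ {P α Y l z} → l ∈ Y → z ∈ dep P (proj₂ l) → z ∉ map proj₂ α → z ∈ extDeps P α Y
∈-extDeps⁺ {P} {α} l∈Y z∈dep z∉α =
  ∈-filter⁺ (λ u → T? (not (u ∈ᵇ map proj₂ α)))
            (∈-concatMap⁺ (λ l → dep P (proj₂ l)) (lose l∈Y z∈dep))
            (substᵖ (λ c → T (not c)) (sym (∈ᵇ-∉ z∉α)) tt)

extDeps-⊆-univ : ∀ {P α Y} → WellFormedPrefix P → All (λ l → InPrefix P (proj₂ l)) Y →
                 extDeps P α Y ⊆ univ P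
extDeps-⊆-univ {P} {α} {Y} wf Y⊆P z∈ext
  with _ , l∈Y , z∈dep ← find (∈-concatMap⁻ (λ l → dep P (proj₂ l))
                                 (proj₁ (∈-filter⁻ (λ u → T? (not (u ∈ᵇ map proj₂ α))) z∈ext)))
  = dep-⊆-univ wf (All.lookup Y⊆P l∈Y) z∈dep

skolem-addExist : ∀ {P f v D h} → v ∉ existVars P → SkolemFor P f → DependsOnlyOn D h →
                  SkolemFor (addExist v D P) (f [ v ↦ h ])
skolem-addExist {f = f} {v} {h = h} _ _ h-dep (here refl) =
  substᵖ (DependsOnlyOn _) (sym (update-≡ f v h)) h-dep
skolem-addExist {P} {f} {v} {h = h} v∉E sk h-dep {x} (there x∈E) =
  substᵖ (DependsOnlyOn _) (sym (update-≢ f h x≢v)) (sk x∈E)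
  where
  x≢v : x ≢ v
  x≢v x≡v = v∉E (substᵖ (_∈ existVars P) x≡v (∈-map⁺ proj₁ x∈E))

extend-addExist-fresh : ∀ {P f v} → WellFormedPrefix P → SkolemFor P f → ¬ InPrefix P v → ∀ D h τ →
                        extend (addExist v D P) (f [ v ↦ h ]) τ ≗ extend P f (τ [ v ↦ h τ ])
extend-addExist-fresh {P} {f} {v} wf sk v∉P D h τ w =
  trans (extend-addExist {P} {f} v D h τ w)
        (sym (extend-update {P} sk (λ v∈E → v∉P (inj₂ v∈E))
                                   (λ w∈E v∈D → v∉P (inj₁ (deps-univ wf w∈E v∈D)))))

holds-addExist : ∀ {P f Γ v} → WellFormedPrefix P → SkolemFor P f → ¬ InPrefix P v → ∀ D h →
                 (∀ τ → All (Holds (extend P f τ)) Γ) →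
                 ∀ τ → All (Holds (extend (addExist v D P) (f [ v ↦ h ]) τ)) Γ
holds-addExist {v = v} wf sk v∉P D h sat τ =
  All.map (λ {A} → holds-cong (λ w → sym (extend-addExist-fresh wf sk v∉P D h τ w)) {A})
          (sat (τ [ v ↦ h τ ]))

forced-depends : ∀ {P f} α Y B → SkolemFor P f → (∀ {w} → w ∈ vars B → w ∈ map proj₂ Y) →
                 DependsOnlyOn (extDeps P α Y) (λ τ → eval (extend P f (makeTrue α τ)) B)
forced-depends {P} {f} α Y B sk B⊆Y τ τ' agree = eval-cong B agree-on-B
  where
  agree-on-B : ∀ {w} → w ∈ vars B → extend P f (makeTrue α τ) w ≡ extend P f (makeTrue α τ') w
  agree-on-B w∈B with l , l∈Y , refl ← ∈-map⁻ proj₂ (B⊆Y w∈B) =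
    extend-cong {P} sk (proj₂ l) λ {z} z∈dep →
      makeTrue-cong α z λ z∉α → agree (∈-extDeps⁺ {P} l∈Y z∈dep z∉α)

frege-preserves : ∀ {P Γ} r σ → SoundRule r → All (_∈ Γ) (map (subst σ) (premises r)) →
                  IsTrue (mkDQBF P Γ) → IsTrue (mkDQBF P (subst σ (conclusion r) ∷ Γ))
frege-preserves r σ sr premises∈Γ (f , sk , sat) =
  f , sk , λ τ → sound-instance {r} sr _ σ (All.map (All.lookup (sat τ)) premises∈Γ) ∷ sat τ

∀red-preserves : ∀ {P Γ L} u b → WellFormedPrefix P → u ∈ univ P →
                 (∀ {x D} → (x , D) ∈ exist P → x ∈ vars L → u ∉ D) → L ∈ Γ →
                 IsTrue (mkDQBF P Γ) → IsTrue (mkDQBF P (subst (redSubst u b) L ∷ Γ))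
∀red-preserves {P} {L = L} u b wf u∈U indep L∈Γ (f , sk , sat) = f , sk , λ τ → reduct-holds τ ∷ sat τ
  where
  reduct-holds : ∀ τ → Holds (extend P f τ) (subst (redSubst u b) L)
  reduct-holds τ = begin
    eval (extend P f τ) (subst (redSubst u b) L)  ≡⟨ eval-reduct (extend P f τ) u b L ⟩
    eval (extend P f τ [ u ↦ b ]) L               ≡⟨ eval-cong L (λ w∈L → sym (extend-update {P} sk
                                                        (disjoint wf u∈U) (λ w∈E → indep w∈E w∈L))) ⟩
    eval (extend P f (τ [ u ↦ b ])) L             ≡⟨ All.lookup (sat (τ [ u ↦ b ])) L∈Γ ⟩
    true                                          ∎
    where open ≡-Reasoning

addExist-preserves : ∀ {P Γ v} D → WellFormedPrefix P → ¬ InPrefix P v →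
                     IsTrue (mkDQBF P Γ) → IsTrue (mkDQBF (addExist v D P) Γ)
addExist-preserves {P} {v = v} D wf v∉P (f , sk , sat) =
  f [ v ↦ (λ _ → false) ] ,
  skolem-addExist {P} (λ v∈E → v∉P (inj₂ v∈E)) sk (λ _ _ _ → refl) ,
  holds-addExist {P} wf sk v∉P D (λ _ → false) sat

indExt-preserves : ∀ {P Γ} α Y v B → WellFormedPrefix P →
                   All (λ l → proj₂ l ∈ univ P) α → All (λ l → InPrefix P (proj₂ l)) Y →
                   (∀ {w} → w ∈ vars B → w ∈ map proj₂ Y) → ¬ InPrefix P v → IsTrue (mkDQBF P Γ) →
                   IsTrue (mkDQBF (addExist v (extDeps P α Y) P) ((bigAnd (map litFm α) ⇒f (var v ⇔f B)) ∷ Γ))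
indExt-preserves {P} α Y v B wf α⊆U Y⊆P B⊆Y v∉P (f , sk , sat) =
  f [ v ↦ h ] , skolem-addExist {P} (λ v∈E → v∉P (inj₂ v∈E)) sk (forced-depends {P} α Y B sk B⊆Y) ,
  λ τ → definition-holds τ ∷ holds-addExist {P} wf sk v∉P (extDeps P α Y) h sat τ
  where
  h : Assignment → Bool
  h τ = eval (extend P f (makeTrue α τ)) B

  A = bigAnd (map litFm α)

  definition-holds : ∀ τ → Holds (extend (addExist v (extDeps P α Y) P) (f [ v ↦ h ]) τ) (A ⇒f (var v ⇔f B))
  definition-holds τ = ⇒b-intro λ A-holds → ⇔b-≡ (begin
    ρ v                            ≡⟨ extend-addExist {P} {f} v (extDeps P α Y) h τ v ⟩
    (extend P f τ [ v ↦ h τ ]) v   ≡⟨ update-≡ (extend P f τ) v (h τ) ⟩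
    h τ                            ≡⟨ eval-cong B (λ {w} _ → extend-cong {P} sk w
                                        (λ {z} _ → makeTrue-id α τ (A-at-τ A-holds) z)) ⟩
    eval (extend P f τ) B          ≡⟨ eval-cong B (λ w∈B → sym (ρ-old (Y-≢-v (B⊆Y w∈B)))) ⟩
    eval ρ B                       ∎)
    where
    open ≡-Reasoning
    ρ = extend (addExist v (extDeps P α Y) P) (f [ v ↦ h ]) τ

    ρ-old : ∀ {w} → w ≢ v → ρ w ≡ extend P f τ w
    ρ-old {w} w≢v =
      trans (extend-addExist {P} {f} v (extDeps P α Y) h τ w) (update-≢ (extend P f τ) (h τ) w≢v)

    Y-≢-v : ∀ {w} → w ∈ map proj₂ Y → w ≢ v
    Y-≢-v w∈Y refl = v∉P (All.lookup (map⁺ Y⊆P) w∈Y)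

    A-at-τ : Holds ρ A → Holds τ A
    A-at-τ = trans (sym (eval-cong A λ w∈A → ρ-is-τ (All.lookup (map⁺ α⊆U) (vars-bigAnd-lits α w∈A))))
      where
      ρ-is-τ : ∀ {w} → w ∈ univ P → ρ w ≡ τ w
      ρ-is-τ w∈U = trans (ρ-old (λ { refl → v∉P (inj₁ w∈U) })) (extend-∉ P f τ (disjoint wf w∈U))

module _ (F : FregeSystem) (Q : DQBF) where

  Invariant : Config → Set
  Invariant c = WellFormedPrefix (pfx c) × IsTrue (mkDQBF (pfx c) (lines c ++ matrix Q))

  step-preserves : ∀ {c c'} → Step F Q c c' → Invariant c → Invariant c'
  step-preserves {cfg P _} (frege {r = r} r∈F σ prem) (wf , t) =
    wf , frege-preserves {P} r σ (All.lookup (sound F) r∈F) (All.map ∈-++⁺ˡ prem) t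
  step-preserves {cfg _ ls} (axiom A∈Q) (wf , (f , sk , sat)) =
    wf , (f , sk , λ τ → All.lookup (sat τ) (∈-++⁺ʳ ls A∈Q) ∷ sat τ)
  step-preserves (indExtAnd α Y v α⊆U Y⊆P (v∉P , _)) (wf , t) =
    wf-addExist wf v∉P (extDeps-⊆-univ {α = α} wf Y⊆P) ,
    indExt-preserves α Y v _ wf α⊆U Y⊆P (vars-bigAnd-lits Y) v∉P t
  step-preserves (indExtOr α Y v α⊆U Y⊆P (v∉P , _)) (wf , t) =
    wf-addExist wf v∉P (extDeps-⊆-univ {α = α} wf Y⊆P) ,
    indExt-preserves α Y v _ wf α⊆U Y⊆P (vars-bigOr-lits Y) v∉P t
  step-preserves (∀red u b L∈ls u∈U indep) (wf , t) =
    wf , ∀red-preserves u b wf u∈U indep (∈-++⁺ˡ L∈ls) t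
  step-preserves (weakenU u u∉P _) (wf , t) = wf-addUniv wf u∉P , t
  step-preserves (weakenE w D w∉P _ D⊆U) (wf , t) =
    wf-addExist wf w∉P D⊆U , addExist-preserves D wf w∉P t

  derivation-preserves : ∀ {c c'} → Star (Step F Q) c c' → Invariant c → Invariant c'
  derivation-preserves ε        inv = inv
  derivation-preserves (s ◅ ss) inv = derivation-preserves ss (step-preserves s inv)

⊥f-first-unsatisfiable : ∀ {ρ} ls Γ → head ls ≡ just ⊥f → ¬ All (Holds ρ) (ls ++ Γ)
⊥f-first-unsatisfiable (.⊥f ∷ _) Γ refl (() ∷ _)

theorem2 : (F : FregeSystem) (Q : DQBF) → WellFormed Q → Refutation F Q → IsFalse Q
theorem2 F Q wf (c , derivation , ends-in-⊥) Q-true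
  with _ , (_ , _ , sat) ← derivation-preserves F Q derivation (wellFormedPrefix wf , Q-true)
  = ⊥f-first-unsatisfiable (lines c) (matrix Q) ends-in-⊥ (sat (λ _ → false))
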